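{- Let $k \geq 2$ be an even integer and let $\Gamma$ be an abelian group (written additively) with $|\Gamma| = n$. Suppose $S \subseteq \Gamma$ is symmetric, i.e. $S = -S := \{ -s : s \in S\}$, and satisfies \[ \mathcal{R}_k(S) = \Gamma \setminus (S \cup \{0\}) \quad\text{and}\quad 0 \notin (k+1)S. \] Then the Cayley graph $\mathrm{Cay}(\Gamma, S)$ is a $C_{k+1}$-saturated, $|S|$-regular graph with $n$ vertices.
   Context: For $S \subseteq \Gamma$ and an integer $m \geq 1$, $mS = \{s_1 + \dots + s_m : s_i \in S\}$ is the $m$-fold sumset. $\mathcal{R}_k(S) = \{ s_1 + s_2 + \dots + s_k : s_i \in S \text{ and } s_i + s_{i+1} + \dots + s_j \neq 0 \text{ for all } 1 \leq i < j \leq k\}$, i.e. the set of $k$-fold sums of elements of $S$ that admit a representation in which no sum of consecutive terms $s_i+\dots+s_j$ ($i<j$) equals $0$. The Cayley graph $\mathrm{Cay}(\Gamma,S)$ (for symmetric $S$ not containing $0$) has vertex set $\Gamma$, with $g,h$ adjacent iff $h - g \in S$. $C_m$ denotes the cycle of length $m$. A graph $G$ is $F$-saturated if $G$ contains no subgraph isomorphic to $F$, but adding any edge between two nonadjacent vertices of $G$ creates a subgraph isomorphic to $F$. -}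

module Defs where

open import Data.Nat using (ℕ; zero; suc; _≤_)
open import Data.Fin using (Fin; zero; suc; inject₁; fromℕ)
open import Data.Fin.Subset using (Subset; _∈_; _∉_; ∣_∣)
open import Data.Vec using (tabulate)
open import Data.Bool using (Bool)
open import Data.List using (List; []; _∷_; _++_; length; foldr)
open import Data.List.Relation.Unary.All using (All)
open import Data.Product using (Σ; _×_; ∃; _,_)
open import Data.Sum using (_⊎_)
open import Relation.Binary.PropositionalEquality using (_≡_; _≢_)
open import Relation.Nullary using (¬_)
open import Function.Definitions using (Injective)
open import Algebra.Structures using (IsAbelianGroup)
open import Level using (0ℓ)

-- A finite abelian group of order n, with carrier Fin n (every abelian
-- group of order n is isomorphic to one of this form).
record FinAbGroup (n : ℕ) : Set where
  field
    _+_ : Fin n → Fin n → Fin n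
    -_  : Fin n → Fin n
    0#  : Fin n
    isAbelianGroup : IsAbelianGroup _≡_ _+_ 0# -_
  infixl 6 _+_
  infix 8 -_

  _-_ : Fin n → Fin n → Fin n
  x - y = x + (- y)

  sumG : List (Fin n) → Fin n
  sumG = foldr _+_ 0#

module _ {n : ℕ} (G : FinAbGroup n) where
  open FinAbGroup G

  Symmetric : Subset n → Set
  Symmetric S = (x : Fin n) → (x ∈ S → (- x) ∈ S) × ((- x) ∈ S → x ∈ S)

  InSumset : ℕ → Subset n → Fin n → Set
  InSumset m S x = Σ (List (Fin n)) λ xs →
    length xs ≡ m × All (_∈ S) xs × sumG xs ≡ x

  InRk : ℕ → Subset n → Fin n → Set
  InRk k S x = Σ (List (Fin n)) λ xs →
    length xs ≡ k × All (_∈ S) xs × sumG xs ≡ x ×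
    ((ys zs ws : List (Fin n)) → xs ≡ ys ++ (zs ++ ws) →
      2 ≤ length zs → sumG zs ≢ 0#)

  CayAdj : Subset n → Fin n → Fin n → Set
  CayAdj S g h = (h - g) ∈ S

  CayNbhd : Subset n → Fin n → Subset n
  CayNbhd S g = tabulate λ h → Data.Vec.lookup S (h - g)
    where import Data.Vec

-- G contains a subgraph isomorphic to the cycle C_{m+1}
-- (vertices f 0, …, f m, distinct, consecutive ones and f m, f 0 adjacent)
HasCycle : {n : ℕ} → (Fin n → Fin n → Set) → ℕ → Set
HasCycle {n} Adj m = Σ (Fin (suc m) → Fin n) λ f →
  Injective _≡_ _≡_ f ×
  ((i : Fin m) → Adj (f (inject₁ i)) (f (suc i))) ×
  Adj (f (fromℕ m)) (f zero)

AddEdge : {n : ℕ} → (Fin n → Fin n → Set) → Fin n → Fin n → Fin n → Fin n → Set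
AddEdge Adj u v x y = Adj x y ⊎ ((x ≡ u × y ≡ v) ⊎ (x ≡ v × y ≡ u))

CycleSaturated : {n : ℕ} → (Fin n → Fin n → Set) → ℕ → Set
CycleSaturated {n} Adj m =
  ¬ HasCycle Adj m ×
  ((u v : Fin n) → u ≢ v → ¬ Adj u v → HasCycle (AddEdge Adj u v) m)

IsSimpleGraph : {n : ℕ} → (Fin n → Fin n → Set) → Set
IsSimpleGraph {n} Adj = ((x y : Fin n) → Adj x y → Adj y x) × ((x : Fin n) → ¬ Adj x x)

-- If a closed walk of length k + 1 existed in Cay(Γ,S), its k + 1 steps would be
-- elements of S summing to 0. Conversely, if u, v are distinct and non-adjacent,
-- then v - u ∉ S ∪ {0}, so v - u = s₁ + … + s_k with no consecutive block of
-- the sᵢ summing to 0; the walk u, u + s₁, …, u + s₁ + … + s_k = v then visits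
-- distinct vertices, and together with the new edge vu it is a (k+1)-cycle.
-- Regularity holds because translation by g is a bijection of Γ.
module Submission where

open import Defs
open import Data.Nat using (ℕ; suc; _≤_)
open import Data.Nat.Divisibility using (_∣_)
open import Data.Fin using (Fin)
open import Data.Fin.Subset using (Subset; _∈_; _∉_; ∣_∣)
open import Data.Product using (_×_)
open import Relation.Binary.PropositionalEquality using (_≡_; _≢_)
open import Relation.Nullary using (¬_)

open import Algebra.Bundles using (AbelianGroup)
open import Algebra.Structures using (IsAbelianGroup)
import Algebra.Properties.AbelianGroup as AbelianGroupProperties
import Algebra.Properties.CommutativeMonoid.Sum as CommutativeMonoidSum
open import Data.Bool using (Bool; true; false)
open import Data.Empty using (⊥-elim)
open import Data.Fin using (zero; suc; inject₁; fromℕ; toℕ)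
open import Data.Fin.Permutation using (Permutation; permutation; _⟨$⟩ʳ_)
open import Data.List using (List; []; _∷_; _++_; length; replicate; take; drop)
open import Data.List.Properties using (length-replicate; take++drop≡id)
open import Data.List.Relation.Unary.All using (All; []; _∷_)
open import Data.List.Relation.Unary.All.Properties using (replicate⁺; ++⁻ʳ)
open import Data.Nat using (s≤s; z≤n)
open import Data.Nat.Properties using (+-0-commutativeMonoid)
open import Data.Product using (_,_; proj₁; proj₂)
open import Data.Sum using (inj₁; inj₂)
open import Data.Vec using ([]; _∷_; tabulate; lookup)
open import Data.Vec.Properties using (lookup∘tabulate)
open import Function using (_∘_)
open import Function.Definitions using (Injective)
open import Level using (0ℓ)
open import Relation.Binary.PropositionalEquality
  using (refl; sym; trans; cong; subst; module ≡-Reasoning)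

open CommutativeMonoidSum +-0-commutativeMonoid using (sum-permute; sum-syntax; sum-cong-≗)

indicator : Bool → ℕ
indicator true  = 1
indicator false = 0

∣p∣≡∑indicator : ∀ {n} (p : Subset n) → ∣ p ∣ ≡ ∑[ i < n ] indicator (lookup p i)
∣p∣≡∑indicator []          = refl
∣p∣≡∑indicator (true  ∷ p) = cong suc (∣p∣≡∑indicator p)
∣p∣≡∑indicator (false ∷ p) = ∣p∣≡∑indicator p

∣p∘π∣≡∣p∣ : ∀ {n} (p : Subset n) (π : Permutation n n) →
            ∣ tabulate (lookup p ∘ (π ⟨$⟩ʳ_)) ∣ ≡ ∣ p ∣
∣p∘π∣≡∣p∣ {n} p π = begin
  ∣ tabulate (lookup p ∘ (π ⟨$⟩ʳ_)) ∣
    ≡⟨ ∣p∣≡∑indicator (tabulate (lookup p ∘ (π ⟨$⟩ʳ_))) ⟩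
  ∑[ i < n ] indicator (lookup (tabulate (lookup p ∘ (π ⟨$⟩ʳ_))) i)
    ≡⟨ sum-cong-≗ (cong indicator ∘ lookup∘tabulate (lookup p ∘ (π ⟨$⟩ʳ_))) ⟩
  ∑[ i < n ] indicator (lookup p (π ⟨$⟩ʳ i))
    ≡⟨ sym (sum-permute (indicator ∘ lookup p) π) ⟩
  ∑[ i < n ] indicator (lookup p i)
    ≡⟨ sym (∣p∣≡∑indicator p) ⟩
  ∣ p ∣ ∎
  where open ≡-Reasoning

module _ {n : ℕ} (G : FinAbGroup n) where
  open FinAbGroup G
  open IsAbelianGroup isAbelianGroup using (assoc; comm; identityʳ; inverseʳ)

  abelianGroup : AbelianGroup 0ℓ 0ℓ
  abelianGroup = record { isAbelianGroup = isAbelianGroup }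

  open AbelianGroupProperties abelianGroup
    using (//-rightDividesˡ; //-rightDividesʳ; identityʳ-unique; ⁻¹-anti-homo‿-; x∙y⁻¹≈ε⇒x≈y)

  a+[b-a]≡b : ∀ a b → a + (b - a) ≡ b
  a+[b-a]≡b a b = trans (comm a (b - a)) (//-rightDividesˡ a b)

  [a+b]-a≡b : ∀ a b → (a + b) - a ≡ b
  [a+b]-a≡b a b = trans (cong (_- a) (comm a b)) (//-rightDividesʳ a b)

  translation : Fin n → Permutation n n
  translation g = permutation (_- g) (_+ g) (λ h → //-rightDividesʳ g h) (λ h → //-rightDividesˡ g h)

  sumG-replicate-0# : ∀ m → sumG (replicate m 0#) ≡ 0#
  sumG-replicate-0# 0 = refl
  sumG-replicate-0# (suc m) = trans (cong (0# +_) (sumG-replicate-0# m)) (identityʳ 0#)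

  0#∈S⇒0#∈mS : ∀ {S} → 0# ∈ S → ∀ m → InSumset G m S 0#
  0#∈S⇒0#∈mS 0∈S m = replicate m 0# , length-replicate m , replicate⁺ m 0∈S , sumG-replicate-0# m

  steps : ∀ m → (Fin (suc m) → Fin n) → List (Fin n)
  steps 0 f = []
  steps (suc m) f = (f (suc zero) - f zero) ∷ steps m (f ∘ suc)

  length-steps : ∀ m f → length (steps m f) ≡ m
  length-steps 0 f = refl
  length-steps (suc m) f = cong suc (length-steps m (f ∘ suc))

  All-steps : ∀ {S} m f → ((i : Fin m) → CayAdj G S (f (inject₁ i)) (f (suc i))) →
              All (_∈ S) (steps m f)
  All-steps 0 f adj = []
  All-steps (suc m) f adj = adj zero ∷ All-steps m (f ∘ suc) (adj ∘ suc)

  start+sumG-steps : ∀ m f → f zero + sumG (steps m f) ≡ f (fromℕ m)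
  start+sumG-steps 0 f = identityʳ (f zero)
  start+sumG-steps (suc m) f = begin
    f zero + ((f (suc zero) - f zero) + sumG (steps m (f ∘ suc)))
      ≡⟨ sym (assoc (f zero) _ _) ⟩
    (f zero + (f (suc zero) - f zero)) + sumG (steps m (f ∘ suc))
      ≡⟨ cong (_+ sumG (steps m (f ∘ suc))) (a+[b-a]≡b (f zero) (f (suc zero))) ⟩
    f (suc zero) + sumG (steps m (f ∘ suc))
      ≡⟨ start+sumG-steps m (f ∘ suc) ⟩
    f (fromℕ (suc m)) ∎
    where open ≡-Reasoning

  HasCycle⇒0#∈sumset : ∀ {S} m → HasCycle (CayAdj G S) m → InSumset G (suc m) S 0#
  HasCycle⇒0#∈sumset m (f , _ , adj , close) =
    closing ∷ steps m f , cong suc (length-steps m f) , close ∷ All-steps m f adj ,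
    identityʳ-unique (f (fromℕ m)) _ returns
    where
    open ≡-Reasoning
    closing : Fin n
    closing = f zero - f (fromℕ m)
    returns : f (fromℕ m) + (closing + sumG (steps m f)) ≡ f (fromℕ m)
    returns = begin
      f (fromℕ m) + (closing + sumG (steps m f)) ≡⟨ sym (assoc (f (fromℕ m)) closing _) ⟩
      (f (fromℕ m) + closing) + sumG (steps m f) ≡⟨ cong (_+ sumG (steps m f)) (a+[b-a]≡b _ _) ⟩
      f zero + sumG (steps m f)                  ≡⟨ start+sumG-steps m f ⟩
      f (fromℕ m)                                ∎

  NoZeroBlock : ℕ → List (Fin n) → Set
  NoZeroBlock m xs = (ys zs ws : List (Fin n)) → xs ≡ ys ++ (zs ++ ws) →
                     m ≤ length zs → sumG zs ≢ 0#

  NoZeroBlock-∷⁻ : ∀ {m x xs} → NoZeroBlock m (x ∷ xs) → NoZeroBlock m xs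
  NoZeroBlock-∷⁻ {x = x} free ys zs ws eq = free (x ∷ ys) zs ws (cong (x ∷_) eq)

  NoZeroBlock-2⇒1 : ∀ {S xs} → 0# ∉ S → All (_∈ S) xs → NoZeroBlock 2 xs → NoZeroBlock 1 xs
  NoZeroBlock-2⇒1 0∉S all free ys (z ∷ []) ws refl _ z≡0 with ++⁻ʳ ys all
  ... | z∈S ∷ _ = 0∉S (subst (_∈ _) (trans (sym (identityʳ z)) z≡0) z∈S)
  NoZeroBlock-2⇒1 0∉S all free ys zs@(_ ∷ _ ∷ _) ws eq _ = free ys zs ws eq (s≤s (s≤s z≤n))

  walk : Fin n → (xs : List (Fin n)) → Fin (suc (length xs)) → Fin n
  walk u xs       zero    = u
  walk u (x ∷ xs) (suc i) = walk (u + x) xs i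

  walk-step : ∀ {P : Fin n → Set} u {xs} → All P xs → (i : Fin (length xs)) →
              P (walk u xs (suc i) - walk u xs (inject₁ i))
  walk-step {P} u {x ∷ _} (px ∷ _)  zero    = subst P (sym ([a+b]-a≡b u x)) px
  walk-step     u {x ∷ _} (_  ∷ all) (suc i) = walk-step (u + x) all i

  walk-end : ∀ u xs → walk u xs (fromℕ (length xs)) ≡ u + sumG xs
  walk-end u []       = sym (identityʳ u)
  walk-end u (x ∷ xs) = trans (walk-end (u + x) xs) (assoc u x (sumG xs))

  walk-prefix : ∀ u xs (i : Fin (suc (length xs))) →
                walk u xs i ≡ u + sumG (take (toℕ i) xs)
  walk-prefix u xs       zero    = sym (identityʳ u)
  walk-prefix u (x ∷ xs) (suc i) = trans (walk-prefix (u + x) xs i) (assoc u x _)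

  walk-leaves-start : ∀ u xs → NoZeroBlock 1 xs → (i : Fin (length xs)) → walk u xs (suc i) ≢ u
  walk-leaves-start u (x ∷ xs) free i returns =
    free [] (x ∷ take (toℕ i) xs) (drop (toℕ i) xs)
         (cong (x ∷_) (sym (take++drop≡id (toℕ i) xs))) (s≤s z≤n)
         (identityʳ-unique u _ (trans (sym (walk-prefix u (x ∷ xs) (suc i))) returns))

  walk-injective : ∀ u xs → NoZeroBlock 1 xs → Injective _≡_ _≡_ (walk u xs)
  walk-injective u xs       free {zero}  {zero}  _ = refl
  walk-injective u xs       free {zero}  {suc j} e = ⊥-elim (walk-leaves-start u xs free j (sym e))
  walk-injective u xs       free {suc i} {zero}  e = ⊥-elim (walk-leaves-start u xs free i e)
  walk-injective u (x ∷ xs) free {suc i} {suc j} e =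
    cong suc (walk-injective (u + x) xs (NoZeroBlock-∷⁻ free) e)

  InRk⇒HasCycle-AddEdge : ∀ {S} k u v → 0# ∉ S → InRk G k S (v - u) →
                          HasCycle (AddEdge (CayAdj G S) u v) k
  InRk⇒HasCycle-AddEdge k u v 0∉S (xs , refl , all , sum≡v-u , free) =
    walk u xs ,
    walk-injective u xs (NoZeroBlock-2⇒1 0∉S all free) ,
    (λ i → inj₁ (walk-step u all i)) ,
    inj₂ (inj₂ (trans (walk-end u xs) (trans (cong (u +_) sum≡v-u) (a+[b-a]≡b u v)) , refl))

  Cay-symmetric : ∀ {S} → Symmetric G S → ∀ x y → CayAdj G S x y → CayAdj G S y x
  Cay-symmetric symS x y x~y = subst (_∈ _) (⁻¹-anti-homo‿- y x) (proj₁ (symS (y - x)) x~y)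

  Cay-irreflexive : ∀ {S} → 0# ∉ S → ∀ x → ¬ CayAdj G S x x
  Cay-irreflexive 0∉S x x~x = 0∉S (subst (_∈ _) (inverseʳ x) x~x)

  Cay-regular : ∀ S g → ∣ CayNbhd G S g ∣ ≡ ∣ S ∣
  Cay-regular S g = ∣p∘π∣≡∣p∣ S (translation g)

  u≢v⇒v-u≢0# : ∀ {u v} → u ≢ v → v - u ≢ 0#
  u≢v⇒v-u≢0# u≢v v-u≡0 = u≢v (sym (x∙y⁻¹≈ε⇒x≈y _ _ v-u≡0))

proposition1p3 : (k : ℕ) → 2 ≤ k → 2 ∣ k →
    (n : ℕ) (G : FinAbGroup n) (S : Subset n) →
    Symmetric G S →
    ((x : Fin n) → (InRk G k S x → x ∉ S × x ≢ FinAbGroup.0# G) × (x ∉ S × x ≢ FinAbGroup.0# G → InRk G k S x)) →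
    ¬ InSumset G (suc k) S (FinAbGroup.0# G) →
    IsSimpleGraph (CayAdj G S) ×
    CycleSaturated (CayAdj G S) k ×
    ((g : Fin n) → ∣ CayNbhd G S g ∣ ≡ ∣ S ∣)
proposition1p3 k _ _ n G S symS Rk≡complement 0∉[k+1]S =
  (Cay-symmetric G symS , Cay-irreflexive G 0∉S) ,
  (0∉[k+1]S ∘ HasCycle⇒0#∈sumset G k , saturated) ,
  Cay-regular G S
  where
  open FinAbGroup G using (0#; _-_)

  0∉S : 0# ∉ S
  0∉S 0∈S = 0∉[k+1]S (0#∈S⇒0#∈mS G 0∈S (suc k))

  saturated : ∀ u v → u ≢ v → ¬ CayAdj G S u v → HasCycle (AddEdge (CayAdj G S) u v) k
  saturated u v u≢v u≁v =
    InRk⇒HasCycle-AddEdge G k u v 0∉S (proj₂ (Rk≡complement (v - u)) (u≁v , u≢v⇒v-u≢0# G u≢v))
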